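{- Let $E$ be a set of equations in the language of residuated ortholattices, let $\mathsf V=\mathsf{OML}+E$, let $\mathsf W=\mathsf{ROL}+\mathrm T[E]$, and suppose $\mathsf U$ is a variety of residuated ortholattices with $\mathsf V\subseteq\mathsf U\subseteq\mathsf W$. Then $\mathsf V$ is translatable into $\mathsf U$, i.e., for every set of equations $D\cup\{s\approx t\}$ in the language of residuated ortholattices, $D\models_{\mathsf V}s\approx t$ if and only if $\mathrm T[D]\models_{\mathsf U}\mathrm T(s)\approx\mathrm T(t)$.
   Context: A residuated ortholattice (ROL) is an algebra $(A,\wedge,\vee,\neg,\backslash,0,1)$ where $(A,\wedge,\vee,0,1)$ is a bounded lattice, $\neg$ is an order-reversing involution, and $x\cdot y\le z\iff y\le x\backslash z$ for all $x,y,z$, where $x\cdot y:=x\wedge(\neg x\vee y)$; $\mathsf{ROL}$ is the variety of ROLs. Orthomodular lattices (ortholattices satisfying $x\le y\implies y\approx x\vee(y\wedge\neg x)$) are regarded as ROLs with $x\backslash y:=\neg x\vee(x\wedge y)$; $\mathsf{OML}$ denotes this subvariety. $\mathsf K+E$ is the subvariety of $\mathsf K$ axiomatized by $E$. $\models_{\mathsf K}$ is relative equational consequence: $D\models_{\mathsf K}s\approx t$ iff for every $\mathbf A\in\mathsf K$ and every assignment in $\mathbf A$ satisfying all equations of $D$, also $s\approx t$ holds. Let ${\sim}x:=x\backslash 0$. The translation $\mathrm T$ on ROL terms: $\mathrm T(0)=0$, $\mathrm T(1)=1$, $\mathrm T(x)={\sim}{\sim}x$ for variables, $\mathrm T(\neg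 s)={\sim}\mathrm T(s)$, $\mathrm T(r\star s)=\mathrm T(r)\star\mathrm T(s)$ for $\star\in\{\wedge,\vee,\backslash\}$; $\mathrm T[E]:=\{\mathrm T(u)\approx\mathrm T(v):(u\approx v)\in E\}$. -}

module Defs where

open import Data.Nat using (ℕ)
open import Data.Product using (_×_; _,_; Σ; ∃)
open import Relation.Binary.PropositionalEquality using (_≡_)
open import Function.Bundles using (_⇔_)

record ROL : Set₁ where
  infixr 7 _∧_
  infixr 6 _∨_
  field
    Carrier : Set
    _∧_ _∨_ _\\_ : Carrier → Carrier → Carrier
    ¬_ : Carrier → Carrier
    𝟘 𝟙 : Carrier
    ∧-assoc : ∀ x y z → (x ∧ y) ∧ z ≡ x ∧ (y ∧ z)
    ∨-assoc : ∀ x y z → (x ∨ y) ∨ z ≡ x ∨ (y ∨ z)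
    ∧-comm : ∀ x y → x ∧ y ≡ y ∧ x
    ∨-comm : ∀ x y → x ∨ y ≡ y ∨ x
    ∧-absorbs-∨ : ∀ x y → x ∧ (x ∨ y) ≡ x
    ∨-absorbs-∧ : ∀ x y → x ∨ (x ∧ y) ≡ x
    ∧-identity : ∀ x → x ∧ 𝟙 ≡ x
    ∨-identity : ∀ x → x ∨ 𝟘 ≡ x

  _≤_ : Carrier → Carrier → Set
  x ≤ y = x ∧ y ≡ x

  _·_ : Carrier → Carrier → Carrier
  x · y = x ∧ ((¬ x) ∨ y)

  field
    ¬-involutive : ∀ x → ¬ (¬ x) ≡ x
    ¬-antitone : ∀ x y → x ≤ y → (¬ y) ≤ (¬ x)
    residuated : ∀ x y z → ((x · y) ≤ z) ⇔ (y ≤ (x \\ z))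

infixr 7 _∧ₜ_
infixr 6 _∨ₜ_

data Term : Set where
  var : ℕ → Term
  0ₜ 1ₜ : Term
  ¬ₜ : Term → Term
  _∧ₜ_ _∨ₜ_ _\\ₜ_ : Term → Term → Term

Eqn : Set
Eqn = Term × Term

EqSet : Set₁
EqSet = Eqn → Set

Class : Set₁
Class = ROL → Set

module _ (A : ROL) where
  open ROL A

  ⟦_⟧ : Term → (ℕ → Carrier) → Carrier
  ⟦ var n ⟧ ρ = ρ n
  ⟦ 0ₜ ⟧ ρ = 𝟘
  ⟦ 1ₜ ⟧ ρ = 𝟙
  ⟦ ¬ₜ s ⟧ ρ = ¬ (⟦ s ⟧ ρ)
  ⟦ r ∧ₜ s ⟧ ρ = ⟦ r ⟧ ρ ∧ ⟦ s ⟧ ρ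
  ⟦ r ∨ₜ s ⟧ ρ = ⟦ r ⟧ ρ ∨ ⟦ s ⟧ ρ
  ⟦ r \\ₜ s ⟧ ρ = ⟦ r ⟧ ρ \\ ⟦ s ⟧ ρ

  SatAt : (ℕ → Carrier) → Eqn → Set
  SatAt ρ (s , t) = ⟦ s ⟧ ρ ≡ ⟦ t ⟧ ρ

  Models : EqSet → Set
  Models E = ∀ e → E e → ∀ (ρ : ℕ → Carrier) → SatAt ρ e

  -- A is an orthomodular lattice regarded as an ROL:
  -- ortholattice, orthomodular, and x \ y = ¬x ∨ (x ∧ y)
  IsOML : Set
  IsOML = (∀ x → x ∧ (¬ x) ≡ 𝟘)
        × (∀ x y → x ≤ y → y ≡ x ∨ (y ∧ (¬ x)))
        × (∀ x y → x \\ y ≡ (¬ x) ∨ (x ∧ y))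

ROL+ : EqSet → Class
ROL+ E A = Models A E

OML+ : EqSet → Class
OML+ E A = IsOML A × Models A E

_⊨[_]_ : EqSet → Class → Eqn → Set₁
D ⊨[ K ] e = ∀ (A : ROL) → K A → ∀ (ρ : ℕ → ROL.Carrier A) →
             (∀ d → D d → SatAt A ρ d) → SatAt A ρ e

_⊆_ : Class → Class → Set₁
K ⊆ L = ∀ A → K A → L A

~ₜ : Term → Term
~ₜ x = x \\ₜ 0ₜ

T : Term → Term
T (var n) = ~ₜ (~ₜ (var n))
T 0ₜ = 0ₜ
T 1ₜ = 1ₜ
T (¬ₜ s) = ~ₜ (T s)
T (r ∧ₜ s) = T r ∧ₜ T s
T (r ∨ₜ s) = T r ∨ₜ T s
T (r \\ₜ s) = T r \\ₜ T s

Tₑ : Eqn → Eqn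
Tₑ (s , t) = (T s , T t)

T[_] : EqSet → EqSet
T[ E ] e = Σ Eqn (λ d → E d × e ≡ Tₑ d)

{-# OPTIONS --safe #-}
-- In a residuated ortholattice put ~ x := x \ 0. The elements with ~ ~ x = x
-- form an orthomodular lattice under ∧, ∨, \, the constants and ~ in place of ¬,
-- and evaluating T(u) at ρ is the same as evaluating u in that OML at ~ ~ ∘ ρ.
-- So a ROL satisfying T[E] yields an OML satisfying E, which transports every
-- consequence D ⊨ s ≈ t of OML + E to T[D] ⊨ T(s) ≈ T(t). Conversely ~ = ¬ in
-- an OML, so T is the identity there and OML + E ⊆ U transfers the converse.
-- The lattice facts behind this are that ~ x is the largest element above ¬ x
-- disjoint from x, and that ~ ~ preserves meets.
module Submission where

open import Defs
open import Level using (0ℓ)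
open import Data.Nat using (ℕ)
open import Data.Product using (_,_; Σ; proj₁; proj₂)
open import Data.Product.Properties using (Σ-≡,≡→≡)
open import Function.Base using (_∘_)
open import Function.Bundles using (_⇔_; mk⇔; Equivalence)
open import Relation.Binary.PropositionalEquality
  using (_≡_; refl; sym; trans; cong; cong₂; subst; isEquivalence)
open import Relation.Binary.PropositionalEquality.WithK using (≡-irrelevant)
import Algebra.Lattice.Bundles as Alg
import Algebra.Lattice.Properties.Lattice as AlgLatticeProperties
import Relation.Binary.Lattice as Ord
import Relation.Binary.Lattice.Properties.JoinSemilattice as JoinSemilatticeProperties
import Relation.Binary.Lattice.Properties.MeetSemilattice as MeetSemilatticeProperties
import Relation.Binary.Reasoning.PartialOrder as PartialOrderReasoning

open Equivalence using (to; from)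

module ROLProperties (A : ROL) where

  open ROL A hiding (_≤_; ¬-antitone; residuated) renaming (_·_ to infixl 8 _·_)

  lattice : Alg.Lattice 0ℓ 0ℓ
  lattice = record
    { isLattice = record
      { isEquivalence = isEquivalence
      ; ∨-comm        = ∨-comm
      ; ∨-assoc       = ∨-assoc
      ; ∨-cong        = cong₂ _∨_
      ; ∧-comm        = ∧-comm
      ; ∧-assoc       = ∧-assoc
      ; ∧-cong        = cong₂ _∧_
      ; absorptive    = ∨-absorbs-∧ , ∧-absorbs-∨
      }
    }

  -- The library's natural order x ≡ x ∧ y; ROL._≤_ is its mirror image x ∧ y ≡ x.
  open Ord.Lattice (AlgLatticeProperties.∨-∧-orderTheoreticLattice lattice)
    using (_≤_; poset; joinSemilattice; meetSemilattice
          ; x≤x∨y; y≤x∨y; ∨-least; x∧y≤x; x∧y≤y; ∧-greatest)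
    renaming (refl to ≤-refl; trans to ≤-trans; antisym to ≤-antisym; reflexive to ≤-reflexive)
  open JoinSemilatticeProperties joinSemilattice using (∨-monotonic)
  open MeetSemilatticeProperties meetSemilattice using (∧-monotonic)
  open PartialOrderReasoning poset

  𝟘-minimum : ∀ x → 𝟘 ≤ x
  𝟘-minimum x = ≤-trans (y≤x∨y x 𝟘) (≤-reflexive (∨-identity x))

  𝟙-maximum : ∀ x → x ≤ 𝟙
  𝟙-maximum x = sym (∧-identity x)

  ¬-antitone : ∀ {x y} → x ≤ y → ¬ y ≤ ¬ x
  ¬-antitone {x} {y} x≤y = sym (ROL.¬-antitone A x y (sym x≤y))

  ≤¬-swap : ∀ {x y} → x ≤ ¬ y → y ≤ ¬ x
  ≤¬-swap {x} {y} x≤¬y = subst (_≤ ¬ x) (¬-involutive y) (¬-antitone x≤¬y)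

  ¬≤-swap : ∀ {x y} → ¬ x ≤ y → ¬ y ≤ x
  ¬≤-swap {x} {y} ¬x≤y = subst (¬ y ≤_) (¬-involutive x) (¬-antitone ¬x≤y)

  ¬[x∧y]≤¬x∨¬y : ∀ {x y} → ¬ (x ∧ y) ≤ ¬ x ∨ ¬ y
  ¬[x∧y]≤¬x∨¬y = ¬≤-swap (∧-greatest (¬≤-swap (x≤x∨y _ _)) (¬≤-swap (y≤x∨y _ _)))

  𝟙≤¬x∨¬y : ∀ {x y} → x ∧ y ≤ 𝟘 → 𝟙 ≤ ¬ x ∨ ¬ y
  𝟙≤¬x∨¬y x∧y≤𝟘 = ≤-trans (≤¬-swap (𝟘-minimum _)) (≤-trans (¬-antitone x∧y≤𝟘) ¬[x∧y]≤¬x∨¬y)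

  ·≤⇒≤\\ : ∀ {x y z} → x · y ≤ z → y ≤ x \\ z
  ·≤⇒≤\\ {x} {y} {z} h = sym (to (ROL.residuated A x y z) (sym h))

  ≤\\⇒·≤ : ∀ {x y z} → y ≤ x \\ z → x · y ≤ z
  ≤\\⇒·≤ {x} {y} {z} h = sym (from (ROL.residuated A x y z) (sym h))

  ·-subdistribˡ-∨ : ∀ {x y z} → x · (y ∨ z) ≤ x · y ∨ x · z
  ·-subdistribˡ-∨ = ≤\\⇒·≤ (∨-least (·≤⇒≤\\ (x≤x∨y _ _)) (·≤⇒≤\\ (y≤x∨y _ _)))

  x∧¬x≤𝟘 : ∀ {x} → x ∧ ¬ x ≤ 𝟘
  x∧¬x≤𝟘 = ≤-trans (∧-monotonic ≤-refl (x≤x∨y _ _)) (≤\\⇒·≤ (𝟘-minimum _))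

  ~_ : Carrier → Carrier
  ~ x = x \\ 𝟘

  ¬x≤~x : ∀ {x} → ¬ x ≤ ~ x
  ¬x≤~x = ·≤⇒≤\\ (≤-trans (∧-monotonic ≤-refl (∨-least ≤-refl ≤-refl)) x∧¬x≤𝟘)

  x∧~x≤𝟘 : ∀ {x} → x ∧ ~ x ≤ 𝟘
  x∧~x≤𝟘 = ≤-trans (∧-monotonic ≤-refl (y≤x∨y _ _)) (≤\\⇒·≤ ≤-refl)

  ~x∧x≤𝟘 : ∀ {x} → ~ x ∧ x ≤ 𝟘
  ~x∧x≤𝟘 = ≤-trans (≤-reflexive (∧-comm _ _)) x∧~x≤𝟘

  ~-greatest : ∀ {x z} → ¬ x ≤ z → x ∧ z ≤ 𝟘 → z ≤ ~ x
  ~-greatest ¬x≤z x∧z≤𝟘 = ·≤⇒≤\\ (≤-trans (∧-monotonic ≤-refl (∨-least ¬x≤z ≤-refl)) x∧z≤𝟘)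

  ~-antitone : ∀ {x y} → x ≤ y → ~ y ≤ ~ x
  ~-antitone {x} {y} x≤y = ·≤⇒≤\\ (≤-trans (∧-greatest (x∧y≤x _ _) below-¬x) x∧¬x≤𝟘)
    where
    below-¬x : x · ~ y ≤ ¬ x
    below-¬x = begin
      x ∧ (¬ x ∨ ~ y)      ≤⟨ ∧-monotonic x≤y (y≤x∨y _ _) ⟩
      y · (¬ x ∨ ~ y)      ≤⟨ ·-subdistribˡ-∨ ⟩
      y · ¬ x ∨ y · ~ y    ≤⟨ ∨-monotonic (x∧y≤y _ _) (≤\\⇒·≤ ≤-refl) ⟩
      (¬ y ∨ ¬ x) ∨ 𝟘      ≤⟨ ∨-least (∨-least (¬-antitone x≤y) ≤-refl) (𝟘-minimum _) ⟩
      ¬ x                  ∎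

  ¬~x≤x : ∀ {x} → ¬ (~ x) ≤ x
  ¬~x≤x = ¬≤-swap ¬x≤~x

  x≤~~x : ∀ {x} → x ≤ ~ ~ x
  x≤~~x = ~-greatest ¬~x≤x ~x∧x≤𝟘

  ~-swap : ∀ {x y} → y ≤ ~ x → x ≤ ~ y
  ~-swap y≤~x = ≤-trans x≤~~x (~-antitone y≤~x)

  ~~-monotone : ∀ {x y} → x ≤ y → ~ ~ x ≤ ~ ~ y
  ~~-monotone = ~-antitone ∘ ~-antitone

  ~~-greatest : ∀ {x z} → x ≤ z → ~ x ∧ z ≤ 𝟘 → z ≤ ~ ~ x
  ~~-greatest x≤z = ~-greatest (≤-trans ¬~x≤x x≤z)

  ≤~⇒·≤𝟘 : ∀ {x y} → x ≤ ~ y → x · y ≤ 𝟘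
  ≤~⇒·≤𝟘 = ≤\\⇒·≤ ∘ ~-swap

  ≤𝟘-by-cases : ∀ {x y z} → x · y ≤ 𝟘 → x · z ≤ 𝟘 → x ≤ y ∨ z → x ≤ 𝟘
  ≤𝟘-by-cases {x} {y} {z} x·y≤𝟘 x·z≤𝟘 x≤y∨z = begin
    x                  ≤⟨ ∧-greatest ≤-refl (≤-trans x≤y∨z (y≤x∨y _ _)) ⟩
    x · (y ∨ z)        ≤⟨ ·-subdistribˡ-∨ ⟩
    x · y ∨ x · z      ≤⟨ ∨-least x·y≤𝟘 x·z≤𝟘 ⟩
    𝟘                  ∎

  ≤~~∧disjoint⇒≤𝟘 : ∀ {x y} → x ≤ ~ ~ y → x ∧ y ≤ 𝟘 → x ≤ 𝟘
  ≤~~∧disjoint⇒≤𝟘 {x} {y} x≤~~y x∧y≤𝟘 = begin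
    x                  ≤⟨ ∧-greatest ≤-refl (≤-trans (𝟙-maximum x) (𝟙≤¬x∨¬y x∧y≤𝟘)) ⟩
    x ∧ (¬ x ∨ ¬ y)    ≤⟨ ∧-monotonic ≤-refl (∨-monotonic ≤-refl ¬x≤~x) ⟩
    x · ~ y            ≤⟨ ≤~⇒·≤𝟘 x≤~~y ⟩
    𝟘                  ∎

  ~~x∧~~y≤~~[x∧y] : ∀ {x y} → ~ ~ x ∧ ~ ~ y ≤ ~ ~ (x ∧ y)
  ~~x∧~~y≤~~[x∧y] {x} {y} = ~~-greatest (∧-monotonic x≤~~x x≤~~x) disjoint
    where
    u : Carrier
    u = ~ (x ∧ y) ∧ (~ ~ x ∧ ~ ~ y)
    u∧y∧x≤𝟘 : (u ∧ y) ∧ x ≤ 𝟘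
    u∧y∧x≤𝟘 = begin
      (u ∧ y) ∧ x          ≤⟨ ∧-greatest (≤-trans (x∧y≤x _ _) (≤-trans (x∧y≤x _ _) (x∧y≤x _ _)))
                                         (∧-greatest (x∧y≤y _ _) (≤-trans (x∧y≤x _ _) (x∧y≤y _ _))) ⟩
      ~ (x ∧ y) ∧ (x ∧ y)  ≤⟨ ~x∧x≤𝟘 ⟩
      𝟘                    ∎
    disjoint : u ≤ 𝟘
    disjoint = ≤~~∧disjoint⇒≤𝟘 (≤-trans (x∧y≤y _ _) (x∧y≤y _ _))
      (≤~~∧disjoint⇒≤𝟘 (≤-trans (x∧y≤x _ _) (≤-trans (x∧y≤y _ _) (x∧y≤x _ _))) u∧y∧x≤𝟘)

  Regular : Carrier → Set
  Regular x = ~ ~ x ≡ x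

  ~-regular : ∀ {x} → Regular (~ x)
  ~-regular = ≤-antisym (~-antitone x≤~~x) x≤~~x

  ~𝟘≡𝟙 : ~ 𝟘 ≡ 𝟙
  ~𝟘≡𝟙 = ≤-antisym (𝟙-maximum _) (·≤⇒≤\\ (x∧y≤x _ _))

  ~𝟙≡𝟘 : ~ 𝟙 ≡ 𝟘
  ~𝟙≡𝟘 = ≤-antisym (≤-trans (∧-greatest (𝟙-maximum _) ≤-refl) x∧~x≤𝟘) (𝟘-minimum _)

  𝟘-regular : Regular 𝟘
  𝟘-regular = trans (cong ~_ ~𝟘≡𝟙) ~𝟙≡𝟘

  𝟙-regular : Regular 𝟙
  𝟙-regular = trans (cong ~_ ~𝟙≡𝟘) ~𝟘≡𝟙

  ∧-regular : ∀ {x y} → Regular x → Regular y → Regular (x ∧ y)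
  ∧-regular x-reg y-reg = ≤-antisym
    (∧-greatest (≤-trans (~~-monotone (x∧y≤x _ _)) (≤-reflexive x-reg))
                (≤-trans (~~-monotone (x∧y≤y _ _)) (≤-reflexive y-reg)))
    x≤~~x

  y·x≤~~x : ∀ {x y} → x ≤ y → y · x ≤ ~ ~ x
  y·x≤~~x {x} {y} x≤y = ~~-greatest (∧-greatest x≤y (y≤x∨y _ _)) disjoint
    where
    u : Carrier
    u = ~ x ∧ y · x
    u·¬y≤𝟘 : u · ¬ y ≤ 𝟘
    u·¬y≤𝟘 = ≤-trans (∧-monotonic ≤-refl (∨-least ≤-refl (¬-antitone (≤-trans (x∧y≤y _ _) (x∧y≤x _ _)))))
                     x∧¬x≤𝟘
    disjoint : u ≤ 𝟘
    disjoint = ≤𝟘-by-cases u·¬y≤𝟘 (≤~⇒·≤𝟘 (x∧y≤x _ _)) (≤-trans (x∧y≤y _ _) (x∧y≤y _ _))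

  ~~x≤~~x·x : ∀ {x} → ~ ~ x ≤ ~ ~ x · x
  ~~x≤~~x·x {x} = ∧-greatest ≤-refl (begin
    ~ ~ x              ≤⟨ 𝟙-maximum _ ⟩
    𝟙                  ≤⟨ 𝟙≤¬x∨¬y (≤-trans (∧-monotonic ≤-refl ¬x≤~x) ~x∧x≤𝟘) ⟩
    ¬ (~ ~ x) ∨ ¬ ¬ x  ≡⟨ cong (¬ (~ ~ x) ∨_) (¬-involutive x) ⟩
    ¬ (~ ~ x) ∨ x      ∎)

  ∨-regular : ∀ {x y} → Regular x → Regular y → Regular (x ∨ y)
  ∨-regular {x} {y} x-reg y-reg = ≤-antisym (begin
    ~ ~ (x ∨ y)                          ≤⟨ ~~x≤~~x·x ⟩
    ~ ~ (x ∨ y) · (x ∨ y)                ≤⟨ ·-subdistribˡ-∨ ⟩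
    ~ ~ (x ∨ y) · x ∨ ~ ~ (x ∨ y) · y    ≤⟨ ∨-monotonic (y·x≤~~x (≤-trans (x≤x∨y _ _) x≤~~x))
                                                        (y·x≤~~x (≤-trans (y≤x∨y _ _) x≤~~x)) ⟩
    ~ ~ x ∨ ~ ~ y                        ≡⟨ cong₂ _∨_ x-reg y-reg ⟩
    x ∨ y                                ∎) x≤~~x

  ~x≤~~¬x : ∀ {x} → ~ x ≤ ~ ~ (¬ x)
  ~x≤~~¬x {x} = ~-swap (~~-greatest x≤~¬x disjoint)
    where
    x≤~¬x : x ≤ ~ (¬ x)
    x≤~¬x = ~-greatest (≤-reflexive (¬-involutive x)) (≤-trans (≤-reflexive (∧-comm _ _)) x∧¬x≤𝟘)
    x∨¬x : 𝟙 ≤ x ∨ ¬ x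
    x∨¬x = ≤-trans (𝟙≤¬x∨¬y (≤-trans (≤-reflexive (∧-comm _ _)) x∧¬x≤𝟘))
                   (≤-reflexive (cong (_∨ ¬ x) (¬-involutive x)))
    disjoint : ~ x ∧ ~ (¬ x) ≤ 𝟘
    disjoint = ≤𝟘-by-cases (≤~⇒·≤𝟘 (x∧y≤x _ _)) (≤~⇒·≤𝟘 (x∧y≤y _ _)) (≤-trans (𝟙-maximum _) x∨¬x)

  \\-regular : ∀ {x y} → Regular y → Regular (x \\ y)
  \\-regular {x} {y} y-reg = ≤-antisym (·≤⇒≤\\ (begin
    x ∧ (¬ x ∨ ~ ~ w)        ≤⟨ ∧-monotonic x≤~~x (∨-monotonic ¬x≤~x ≤-refl) ⟩
    ~ ~ x ∧ (~ x ∨ ~ ~ w)    ≤⟨ ∧-monotonic ≤-refl (∨-least (≤-trans ~x≤~~¬x (~~-monotone (x≤x∨y _ _)))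
                                                             (~~-monotone (y≤x∨y _ _))) ⟩
    ~ ~ x ∧ ~ ~ (¬ x ∨ w)    ≤⟨ ~~x∧~~y≤~~[x∧y] ⟩
    ~ ~ (x · w)              ≤⟨ ~~-monotone (≤\\⇒·≤ ≤-refl) ⟩
    ~ ~ y                    ≡⟨ y-reg ⟩
    y                        ∎)) x≤~~x
    where
    w : Carrier
    w = x \\ y

  x·y≡x∧[~x∨y] : ∀ {x y} → x · y ≡ x ∧ (~ x ∨ y)
  x·y≡x∧[~x∨y] {x} {y} = ≤-antisym (∧-monotonic ≤-refl (∨-monotonic ¬x≤~x ≤-refl)) (begin
    x ∧ (~ x ∨ y)            ≤⟨ ∧-greatest (x∧y≤x _ _) (≤-trans (x∧y≤y _ _) (y≤x∨y _ _)) ⟩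
    x · (~ x ∨ y)            ≤⟨ ·-subdistribˡ-∨ ⟩
    x · ~ x ∨ x · y          ≤⟨ ∨-least (≤-trans (≤\\⇒·≤ ≤-refl) (𝟘-minimum _)) ≤-refl ⟩
    x · y                    ∎)

  regular-orthomodular : ∀ {x y} → Regular x → Regular y → x ≤ y → y ≤ x ∨ (y ∧ ~ x)
  regular-orthomodular {x} {y} x-reg y-reg x≤y = ≤-trans
    (~~-greatest (∨-least x≤y (x∧y≤x _ _)) disjoint)
    (≤-reflexive (∨-regular x-reg (∧-regular y-reg ~-regular)))
    where
    disjoint : ~ (x ∨ (y ∧ ~ x)) ∧ y ≤ 𝟘
    disjoint = ≤-trans
      (∧-greatest (∧-greatest (x∧y≤y _ _) (≤-trans (x∧y≤x _ _) (~-antitone (x≤x∨y _ _))))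
                  (≤-trans (x∧y≤x _ _) (~-antitone (y≤x∨y _ _))))
      x∧~x≤𝟘

  x\\y≡~x∨[x∧y] : ∀ {x y} → Regular x → Regular y → x \\ y ≡ ~ x ∨ (x ∧ y)
  x\\y≡~x∨[x∧y] {x} {y} x-reg y-reg = ≤-antisym (begin
    x \\ y                           ≤⟨ y≤x∨y _ _ ⟩
    ~ x ∨ x \\ y                     ≤⟨ regular-orthomodular ~-regular (∨-regular ~-regular (\\-regular y-reg)) (x≤x∨y _ _) ⟩
    ~ x ∨ ((~ x ∨ x \\ y) ∧ ~ ~ x)   ≡⟨ cong (λ z → ~ x ∨ ((~ x ∨ x \\ y) ∧ z)) x-reg ⟩
    ~ x ∨ ((~ x ∨ x \\ y) ∧ x)       ≤⟨ ∨-monotonic ≤-refl (∧-greatest (x∧y≤y _ _) below-y) ⟩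
    ~ x ∨ (x ∧ y)                    ∎)
    (·≤⇒≤\\ (begin
    x · (~ x ∨ (x ∧ y))              ≤⟨ ·-subdistribˡ-∨ ⟩
    x · ~ x ∨ x · (x ∧ y)            ≤⟨ ∨-least (≤-trans (≤\\⇒·≤ ≤-refl) (𝟘-minimum _))
                                                (≤-trans (y·x≤~~x (x∧y≤x _ _)) (≤-reflexive (∧-regular x-reg y-reg))) ⟩
    x ∧ y                            ≤⟨ x∧y≤y _ _ ⟩
    y                                ∎))
    where
    below-y : (~ x ∨ x \\ y) ∧ x ≤ y
    below-y = begin
      (~ x ∨ x \\ y) ∧ x      ≡⟨ ∧-comm _ _ ⟩
      x ∧ (~ x ∨ x \\ y)      ≡⟨ x·y≡x∧[~x∨y] ⟨
      x · (x \\ y)            ≤⟨ ≤\\⇒·≤ ≤-refl ⟩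
      y                       ∎

  RegularElement : Set
  RegularElement = Σ Carrier Regular

  ≡-regular : {a b : RegularElement} → proj₁ a ≡ proj₁ b → a ≡ b
  ≡-regular a≡b = Σ-≡,≡→≡ (a≡b , ≡-irrelevant _ _)

  regularOML : ROL
  regularOML = record
    { Carrier      = RegularElement
    ; _∧_          = λ (x , x-reg) (y , y-reg) → x ∧ y , ∧-regular x-reg y-reg
    ; _∨_          = λ (x , x-reg) (y , y-reg) → x ∨ y , ∨-regular x-reg y-reg
    ; _\\_         = λ (x , _) (y , y-reg) → x \\ y , \\-regular y-reg
    ; ¬_           = λ (x , _) → ~ x , ~-regular
    ; 𝟘            = 𝟘 , 𝟘-regular
    ; 𝟙            = 𝟙 , 𝟙-regular
    ; ∧-assoc      = λ _ _ _ → ≡-regular (∧-assoc _ _ _)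
    ; ∨-assoc      = λ _ _ _ → ≡-regular (∨-assoc _ _ _)
    ; ∧-comm       = λ _ _ → ≡-regular (∧-comm _ _)
    ; ∨-comm       = λ _ _ → ≡-regular (∨-comm _ _)
    ; ∧-absorbs-∨  = λ _ _ → ≡-regular (∧-absorbs-∨ _ _)
    ; ∨-absorbs-∧  = λ _ _ → ≡-regular (∨-absorbs-∧ _ _)
    ; ∧-identity   = λ _ → ≡-regular (∧-identity _)
    ; ∨-identity   = λ _ → ≡-regular (∨-identity _)
    ; ¬-involutive = λ (_ , x-reg) → ≡-regular x-reg
    ; ¬-antitone   = λ _ _ x≤y → ≡-regular (sym (~-antitone (sym (cong proj₁ x≤y))))
    ; residuated   = λ _ _ _ → mk⇔
        (λ x·y≤z → ≡-regular (sym (·≤⇒≤\\ (subst (_≤ _) (sym x·y≡x∧[~x∨y]) (sym (cong proj₁ x·y≤z))))))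
        (λ y≤x\\z → ≡-regular (sym (subst (_≤ _) x·y≡x∧[~x∨y] (≤\\⇒·≤ (sym (cong proj₁ y≤x\\z))))))
    }

  regularOML-isOML : IsOML regularOML
  regularOML-isOML =
      (λ _ → ≡-regular (≤-antisym x∧~x≤𝟘 (𝟘-minimum _)))
    , (λ (_ , x-reg) (_ , y-reg) x≤y → ≡-regular (≤-antisym
        (regular-orthomodular x-reg y-reg (sym (cong proj₁ x≤y)))
        (∨-least (sym (cong proj₁ x≤y)) (x∧y≤x _ _))))
    , (λ (_ , x-reg) (_ , y-reg) → ≡-regular (x\\y≡~x∨[x∧y] x-reg y-reg))

  ⟦⟧-regularOML : ∀ u (σ : ℕ → RegularElement) → proj₁ (⟦_⟧ regularOML u σ) ≡ ⟦_⟧ A (T u) (proj₁ ∘ σ)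
  ⟦⟧-regularOML (var n)    σ = sym (proj₂ (σ n))
  ⟦⟧-regularOML 0ₜ         σ = refl
  ⟦⟧-regularOML 1ₜ         σ = refl
  ⟦⟧-regularOML (¬ₜ u)     σ = cong ~_ (⟦⟧-regularOML u σ)
  ⟦⟧-regularOML (u ∧ₜ v)   σ = cong₂ _∧_ (⟦⟧-regularOML u σ) (⟦⟧-regularOML v σ)
  ⟦⟧-regularOML (u ∨ₜ v)   σ = cong₂ _∨_ (⟦⟧-regularOML u σ) (⟦⟧-regularOML v σ)
  ⟦⟧-regularOML (u \\ₜ v)  σ = cong₂ _\\_ (⟦⟧-regularOML u σ) (⟦⟧-regularOML v σ)

  regularise : (ℕ → Carrier) → ℕ → RegularElement
  regularise ρ n = ~ ~ ρ n , ~-regular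

  ⟦⟧-regularise : ∀ u ρ → proj₁ (⟦_⟧ regularOML u (regularise ρ)) ≡ ⟦_⟧ A (T u) ρ
  ⟦⟧-regularise (var n)    ρ = refl
  ⟦⟧-regularise 0ₜ         ρ = refl
  ⟦⟧-regularise 1ₜ         ρ = refl
  ⟦⟧-regularise (¬ₜ u)     ρ = cong ~_ (⟦⟧-regularise u ρ)
  ⟦⟧-regularise (u ∧ₜ v)   ρ = cong₂ _∧_ (⟦⟧-regularise u ρ) (⟦⟧-regularise v ρ)
  ⟦⟧-regularise (u ∨ₜ v)   ρ = cong₂ _∨_ (⟦⟧-regularise u ρ) (⟦⟧-regularise v ρ)
  ⟦⟧-regularise (u \\ₜ v)  ρ = cong₂ _\\_ (⟦⟧-regularise u ρ) (⟦⟧-regularise v ρ)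

  satAt-regularOML : ∀ σ e → SatAt regularOML σ e ⇔ SatAt A (proj₁ ∘ σ) (Tₑ e)
  satAt-regularOML σ (u , v) = mk⇔
    (λ u≈v → trans (sym (⟦⟧-regularOML u σ)) (trans (cong proj₁ u≈v) (⟦⟧-regularOML v σ)))
    (λ Tu≈Tv → ≡-regular (trans (⟦⟧-regularOML u σ) (trans Tu≈Tv (sym (⟦⟧-regularOML v σ)))))

  satAt-regularise : ∀ ρ e → SatAt regularOML (regularise ρ) e ⇔ SatAt A ρ (Tₑ e)
  satAt-regularise ρ (u , v) = mk⇔
    (λ u≈v → trans (sym (⟦⟧-regularise u ρ)) (trans (cong proj₁ u≈v) (⟦⟧-regularise v ρ)))
    (λ Tu≈Tv → ≡-regular (trans (⟦⟧-regularise u ρ) (trans Tu≈Tv (sym (⟦⟧-regularise v ρ)))))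

  models-regularOML : ∀ {E} → Models A T[ E ] → Models regularOML E
  models-regularOML A⊨TE e e∈E σ = from (satAt-regularOML σ e) (A⊨TE (Tₑ e) (e , e∈E , refl) (proj₁ ∘ σ))

  module _ (isOML : IsOML A) where

    ~≡¬ : ∀ x → ~ x ≡ ¬ x
    ~≡¬ x = begin-equality
      x \\ 𝟘           ≡⟨ proj₂ (proj₂ isOML) x 𝟘 ⟩
      ¬ x ∨ (x ∧ 𝟘)    ≡⟨ cong (¬ x ∨_) (≤-antisym (x∧y≤y _ _) (𝟘-minimum _)) ⟩
      ¬ x ∨ 𝟘          ≡⟨ ∨-identity (¬ x) ⟩
      ¬ x              ∎

    ⟦T⟧-OML : ∀ u ρ → ⟦_⟧ A (T u) ρ ≡ ⟦_⟧ A u ρ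
    ⟦T⟧-OML (var n)    ρ = trans (~≡¬ (~ ρ n)) (trans (cong ¬_ (~≡¬ (ρ n))) (¬-involutive (ρ n)))
    ⟦T⟧-OML 0ₜ         ρ = refl
    ⟦T⟧-OML 1ₜ         ρ = refl
    ⟦T⟧-OML (¬ₜ u)     ρ = trans (~≡¬ _) (cong ¬_ (⟦T⟧-OML u ρ))
    ⟦T⟧-OML (u ∧ₜ v)   ρ = cong₂ _∧_ (⟦T⟧-OML u ρ) (⟦T⟧-OML v ρ)
    ⟦T⟧-OML (u ∨ₜ v)   ρ = cong₂ _∨_ (⟦T⟧-OML u ρ) (⟦T⟧-OML v ρ)
    ⟦T⟧-OML (u \\ₜ v)  ρ = cong₂ _\\_ (⟦T⟧-OML u ρ) (⟦T⟧-OML v ρ)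

    satAt-T-OML : ∀ ρ e → SatAt A ρ (Tₑ e) ⇔ SatAt A ρ e
    satAt-T-OML ρ (u , v) = mk⇔
      (λ Tu≈Tv → trans (sym (⟦T⟧-OML u ρ)) (trans Tu≈Tv (⟦T⟧-OML v ρ)))
      (λ u≈v → trans (⟦T⟧-OML u ρ) (trans u≈v (sym (⟦T⟧-OML v ρ))))

⊨-antitone : ∀ {K L D} e → K ⊆ L → D ⊨[ L ] e → D ⊨[ K ] e
⊨-antitone e K⊆L D⊨e A A∈K = D⊨e A (K⊆L A A∈K)

T-sound : ∀ {E D} e → D ⊨[ OML+ E ] e → T[ D ] ⊨[ ROL+ T[ E ] ] Tₑ e
T-sound e D⊨e A A⊨TE ρ ρ⊨TD = to (satAt-regularise ρ e)
  (D⊨e regularOML (regularOML-isOML , models-regularOML A⊨TE) (regularise ρ)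
    (λ d d∈D → from (satAt-regularise ρ d) (ρ⊨TD (Tₑ d) (d , d∈D , refl))))
  where open ROLProperties A

T-complete : ∀ {K D} e → K ⊆ IsOML → T[ D ] ⊨[ K ] Tₑ e → D ⊨[ K ] e
T-complete e K⊆OML TD⊨Te A A∈K ρ ρ⊨D = to (satAt-T-OML (K⊆OML A A∈K) ρ e)
  (TD⊨Te A A∈K ρ λ { _ (d , d∈D , refl) → from (satAt-T-OML (K⊆OML A A∈K) ρ d) (ρ⊨D d d∈D) })
  where open ROLProperties A

theorem4p11 : (E F : EqSet) →
    OML+ E ⊆ ROL+ F → ROL+ F ⊆ ROL+ T[ E ] →
    ∀ (D : EqSet) (s t : Term) →
    (D ⊨[ OML+ E ] (s , t)) ⇔ (T[ D ] ⊨[ ROL+ F ] (T s , T t))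
theorem4p11 E F OML+E⊆ROL+F ROL+F⊆ROL+T[E] D s t = mk⇔
  (λ D⊨s≈t → ⊨-antitone (T s , T t) ROL+F⊆ROL+T[E] (T-sound (s , t) D⊨s≈t))
  (λ TD⊨Ts≈Tt → T-complete (s , t) (λ _ → proj₁) (⊨-antitone (T s , T t) OML+E⊆ROL+F TD⊨Ts≈Tt))
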